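{- Let $G$ be a finite tree with a proper edge coloring $\kappa:E(G)\to[k]$. Then either the centralizer $C_{S_{V(G)}}(\mathfrak{G}_\kappa)$ of the coloring group in $S_{V(G)}$ is trivial, or $|V(G)|=2m$ is even and $\mathfrak{G}_\kappa$ is isomorphic to a subgroup of the type B Coxeter group $B_m$.
   Context: A proper edge coloring of $G$ on $k$ colors is a surjective map $\kappa:E(G)\to[k]$ such that edges sharing a vertex receive different colors. For $a\in[k]$, $\tau_a\in S_{V(G)}$ is the product of the transpositions $(i,j)$ over all edges $\{i,j\}$ colored $a$, and the coloring group $\mathfrak{G}_\kappa\le S_{V(G)}$ is the subgroup generated by $\tau_1,\dots,\tau_k$. $B_m$ is the hyperoctahedral group of signed permutations of $\{\pm1,\dots,\pm m\}$, i.e. the wreath product $C_2\wr S_m$. -}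

module Defs where

open import Data.Nat using (ℕ; zero; suc; _*_)
open import Data.Fin using (Fin; zero; suc; inject₁; fromℕ; _≟_)
open import Data.Fin.Properties using (any?)
open import Data.Fin.Permutation using (Permutation′; _⟨$⟩ʳ_)
open import Data.Bool using (Bool; not)
open import Data.Maybe using (Maybe; just; nothing)
open import Data.Maybe.Properties using (≡-dec)
open import Data.List using (List; []; _∷_)
open import Data.Product using (Σ; ∃; ∃-syntax; _×_; _,_; proj₁)
open import Data.Sum using (_⊎_)
open import Function using (_∘_; id)
open import Function.Bundles using (_↔_; Inverse)
open import Relation.Nullary using (¬_; yes; no)
open import Relation.Binary.PropositionalEquality using (_≡_; _≢_)

-- An edge-coloured graph with colours in [k] = Fin k is encoded by
--   c : Fin n → Fin n → Maybe (Fin k)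
-- where  c i j ≡ just a  means {i,j} is an edge of colour a, and
--        c i j ≡ nothing means {i,j} is not an edge.

Coloring : ℕ → ℕ → Set
Coloring n k = Fin n → Fin n → Maybe (Fin k)

module _ {n k : ℕ} (c : Coloring n k) where

  IsSimple : Set
  IsSimple = (∀ i → c i i ≡ nothing) × (∀ i j → c i j ≡ c j i)

  Adj : Fin n → Fin n → Set
  Adj i j = c i j ≢ nothing

  IsWalk : (ℓ : ℕ) → (Fin (suc ℓ) → Fin n) → Set
  IsWalk ℓ p = ∀ (i : Fin ℓ) → Adj (p (inject₁ i)) (p (suc i))

  Connected : Set
  Connected = ∀ u v → ∃[ ℓ ] Σ (Fin (suc ℓ) → Fin n) λ p →
                IsWalk ℓ p × p zero ≡ u × p (fromℕ ℓ) ≡ v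

  -- a cycle of length ℓ+3 ≥ 3: pairwise distinct vertices
  -- p 0, …, p (ℓ+2), consecutive ones adjacent, and p (ℓ+2) adjacent to p 0
  IsCycle : (ℓ : ℕ) → (Fin (suc (suc (suc ℓ))) → Fin n) → Set
  IsCycle ℓ p = (∀ i j → p i ≡ p j → i ≡ j)
              × IsWalk (suc (suc ℓ)) p
              × Adj (p (fromℕ (suc (suc ℓ)))) (p zero)

  Acyclic : Set
  Acyclic = ∀ ℓ p → ¬ IsCycle ℓ p

  IsTree : Set
  IsTree = IsSimple × Connected × Acyclic

  IsProper : Set
  IsProper = ∀ i j l a → c i j ≡ just a → c i l ≡ just a → j ≡ l

  IsSurjective : Set
  IsSurjective = ∀ (a : Fin k) → ∃[ i ] ∃[ j ] c i j ≡ just a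

  IsProperEdgeColoring : Set
  IsProperEdgeColoring = IsProper × IsSurjective

  -- τ_a : product of the transpositions (i j) over the edges of colour a
  -- (i.e. swaps the two endpoints of each a-coloured edge, fixes the rest)
  τ : Fin k → Fin n → Fin n
  τ a i with any? (λ j → ≡-dec _≟_ (c i j) (just a))
  ... | yes (j , _) = j
  ... | no _        = i

  evalWord : List (Fin k) → Fin n → Fin n
  evalWord []      = id
  evalWord (a ∷ w) = τ a ∘ evalWord w

  -- membership in the coloring group 𝔊_κ = ⟨τ_1,…,τ_k⟩ ≤ S_V
  -- (each τ_a is an involution, so positive words suffice)
  InColoringGroup : (Fin n → Fin n) → Set
  InColoringGroup f = ∃[ w ] (∀ i → f i ≡ evalWord w i)

  CentralizerTrivial : Set
  CentralizerTrivial =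
    (σ : Permutation′ n) →
    (∀ f → InColoringGroup f → ∀ i → σ ⟨$⟩ʳ (f i) ≡ f (σ ⟨$⟩ʳ i)) →
    ∀ i → σ ⟨$⟩ʳ i ≡ i

-- The hyperoctahedral group B_m: signed permutations of {±1,…,±m},
-- where the signed element ±i is encoded as (i , s) : Fin m × Bool.

negate : {m : ℕ} → Fin m × Bool → Fin m × Bool
negate (i , s) = (i , not s)

SignedPerm : ℕ → Set
SignedPerm m = Σ ((Fin m × Bool) ↔ (Fin m × Bool)) λ π →
                 ∀ x → Inverse.to π (negate x) ≡ negate (Inverse.to π x)

apply : {m : ℕ} → SignedPerm m → Fin m × Bool → Fin m × Bool
apply π = Inverse.to (proj₁ π)

_≈B_ : {m : ℕ} → SignedPerm m → SignedPerm m → Set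
π ≈B ρ = ∀ x → apply π x ≡ apply ρ x

module _ {n k : ℕ} (c : Coloring n k) where

  EmbedsInto : ℕ → Set
  EmbedsInto m =
    Σ ((f : Fin n → Fin n) → InColoringGroup c f → SignedPerm m) λ φ →
      (∀ f g pf pg → (∀ i → f i ≡ g i) → φ f pf ≈B φ g pg)
      × (∀ f g pf pg pfg → ∀ x →
            apply (φ (f ∘ g) pfg) x ≡ apply (φ f pf) (apply (φ g pg) x))
      × (∀ f g pf pg → φ f pf ≈B φ g pg → ∀ i → f i ≡ g i)

{-# OPTIONS --safe #-}
-- A permutation commuting with every τ_a commutes with every walk, so on a connected graph it is
-- determined by the image of one vertex and is the identity once it fixes a vertex; in particular
-- a nontrivial centralizing σ exists iff some candidate image of a base vertex works, which is
-- decidable, and such a σ is fixed-point-free.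
-- On a tree, shorten a walk from x to σ x to a non-backtracking path. If its first and last colours
-- differed, the σ-translates of the path would concatenate to arbitrarily long non-backtracking
-- walks, impossible in a finite tree; so they agree, and stripping them replaces x by its
-- neighbour. Descending to a path of length ≤ 1 gives σ² x = x, hence σ² = id.
-- A fixed-point-free involution pairs up the vertices: |V| = 2m, and V ≅ {±1,…,±m} with σ acting
-- as negation. Conjugation then embeds 𝔊_κ into the centralizer of negation, which is B_m.
module Submission where

open import Defs
open import Data.Bool using (Bool; true; false)
open import Data.Empty using (⊥-elim)
open import Data.Fin as Fin using (Fin; zero; suc; toℕ; fromℕ; _≟_)
open import Data.Fin.Properties as Finₚ
  using (any?; all?; pigeonhole; toℕ-injective; toℕ-inject₁; toℕ-fromℕ; toℕ<n; 2↔Bool; *↔×)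
open import Data.Fin.Permutation using (Permutation′; _⟨$⟩ʳ_; _⟨$⟩ˡ_; inverseˡ; ↔⇒≡)
open import Data.List
  using (List; []; _∷_; [_]; _++_; _∷ʳ_; take; drop; length; lookup; filter; allFin;
         concat; replicate; head; last; initLast; _∷ʳ′_)
open import Data.List.Properties using (length-take; length-drop; take-all; take++drop≡id; length-++-≤ˡ; length-++-≤ʳ)
open import Data.List.Membership.Propositional.Properties using (∈-lookup; ∈-filter⁺; ∈-filter⁻; ∈-allFin)
open import Data.List.Relation.Unary.All as All using ()
open import Data.List.Relation.Unary.AllPairs using (AllPairs; _∷_)
open import Data.List.Relation.Unary.Any as Any using ()
open import Data.List.Relation.Unary.Any.Properties using (lookup-index)
open import Data.List.Relation.Unary.Linked as Linked using (Linked; []; [-]; _∷_)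
open import Data.List.Relation.Unary.Linked.Properties using (++⁺)
open import Data.List.Relation.Unary.Unique.Propositional.Properties using (allFin⁺; filter⁺)
open import Data.Maybe using (just; nothing)
open import Data.Maybe.Properties using (≡-dec; just-injective)
open import Data.Maybe.Relation.Binary.Connected using (just; just-nothing; nothing)
  renaming (Connected to MaybeConnected)
open import Data.Nat using (ℕ; zero; suc; _*_; _+_; _∸_; _⊓_; _≤_; _<_; z≤n; s≤s; _<?_)
open import Data.Nat.Induction using (<-rec)
open import Data.Nat.Properties
  using (≤-refl; ≤-trans; <⇒≤; ≤-pred; ≮⇒≥; ≤∧≢⇒<; <-asym; <⇒≱; ≤-<-trans; *-comm;
         m∸n≤m; m<n⇒0<n∸m; m+[n∸m]≡n; m≤n⇒m⊓n≡m; ∸-monoˡ-≤)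
open import Data.Product using (∃; ∃₂; ∃-syntax; _×_; _,_; proj₁; proj₂)
open import Data.Product.Function.NonDependent.Propositional using (_×-↔_)
open import Data.Sum using (_⊎_; inj₁; inj₂)
open import Data.Unit using (⊤; tt)
open import Function using (_∘_; id; case_of_)
open import Function.Bundles using (_↔_; Inverse; mk↔ₛ′)
open import Function.Construct.Composition using (_↔-∘_)
open import Function.Construct.Identity using (↔-id)
open import Function.Construct.Symmetry using (↔-sym)
open import Function.Definitions using (Injective)
open import Relation.Binary using (Rel; DecidableEquality; tri<; tri≈; tri>)
open import Relation.Binary.PropositionalEquality hiding ([_])
open import Relation.Nullary using (¬_; Dec; yes; no)
open import Relation.Nullary.Decidable using (map′; _×-dec_; _→-dec_; ¬?)

open ≡-Reasoning

lookup-injective : ∀ {a} {A : Set a} {xs : List A} → AllPairs _≢_ xs → Injective _≡_ _≡_ (lookup xs)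
lookup-injective {xs = _ ∷ _} (_ ∷ _)            {zero}  {zero}  _  = refl
lookup-injective {xs = _ ∷ _} (x∉xs ∷ _)         {zero}  {suc j} eq = ⊥-elim (All.lookup x∉xs (∈-lookup j) eq)
lookup-injective {xs = _ ∷ _} (x∉xs ∷ _)         {suc i} {zero}  eq = ⊥-elim (All.lookup x∉xs (∈-lookup i) (sym eq))
lookup-injective {xs = _ ∷ _} (_ ∷ distinct)     {suc i} {suc j} eq = cong suc (lookup-injective distinct eq)

collision-or-injective : ∀ {m} {A : Set} → DecidableEquality A → (f : Fin m → A) →
                         (∃₂ λ i j → i Fin.< j × f i ≡ f j) ⊎ Injective _≡_ _≡_ f
collision-or-injective _≟ᴬ_ f with any? (λ i → any? (λ j → i Finₚ.<? j ×-dec f i ≟ᴬ f j))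
... | yes (i , j , i<j , eq) = inj₁ (i , j , i<j , eq)
... | no noCollision = inj₂ injective
  where
    injective : Injective _≡_ _≡_ f
    injective {i} {j} eq with Finₚ.<-cmp i j
    ... | tri< i<j _ _ = ⊥-elim (noCollision (i , j , i<j , eq))
    ... | tri≈ _ i≡j _ = i≡j
    ... | tri> _ _ j<i = ⊥-elim (noCollision (j , i , j<i , sym eq))

last-∷ʳ : ∀ {A : Set} (xs : List A) x → last (xs ∷ʳ x) ≡ just x
last-∷ʳ []           x = refl
last-∷ʳ (_ ∷ [])     x = refl
last-∷ʳ (_ ∷ y ∷ xs) x = last-∷ʳ (y ∷ xs) x

length-concat-replicate : ∀ {A : Set} (a : A) t j → j ≤ length (concat (replicate j (a ∷ t)))
length-concat-replicate a t zero    = z≤n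
length-concat-replicate a t (suc j) =
  s≤s (≤-trans (length-concat-replicate a t j) (length-++-≤ʳ (concat (replicate j (a ∷ t))) {t}))

module _ {A : Set} {ℓ} {R : Rel A ℓ} where

  Linked-++⁻ : ∀ xs {ys} → Linked R (xs ++ ys) → Linked R xs × Linked R ys
  Linked-++⁻ []           linked        = [] , linked
  Linked-++⁻ (_ ∷ [])     linked        = [-] , Linked.tail linked
  Linked-++⁻ (_ ∷ y ∷ xs) (r ∷ linked) with Linked-++⁻ (y ∷ xs) linked
  ... | linked₁ , linked₂ = r ∷ linked₁ , linked₂

  Linked-concat-replicate : ∀ {a t} → Linked R (a ∷ t) → MaybeConnected R (last (a ∷ t)) (just a) →
                            ∀ j → Linked R (concat (replicate j (a ∷ t)))
  Linked-concat-replicate         linked wraps zero    = []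
  Linked-concat-replicate {a} {t} linked wraps (suc j) =
    ++⁺ linked (glue j) (Linked-concat-replicate linked wraps j)
    where
      glue : ∀ j → MaybeConnected R (last (a ∷ t)) (head (concat (replicate j (a ∷ t))))
      glue (suc _) = wraps
      glue zero with last (a ∷ t)
      ... | just _  = just-nothing
      ... | nothing = nothing

module FixedPointFreeInvolution {n : ℕ} (σ : Fin n → Fin n)
         (σ-involutive : ∀ v → σ (σ v) ≡ v) (σ-fixed-point-free : ∀ v → σ v ≢ v) where

  representatives : List (Fin n)
  representatives = filter (λ v → v Finₚ.<? σ v) (allFin n)

  m : ℕ
  m = length representatives

  rep : Fin m → Fin n
  rep = lookup representatives

  rep< : ∀ i → rep i Fin.< σ (rep i)
  rep< i = proj₂ (∈-filter⁻ (λ v → v Finₚ.<? σ v) {xs = allFin n} (∈-lookup i))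

  rep-injective : Injective _≡_ _≡_ rep
  rep-injective = lookup-injective (filter⁺ (λ v → v Finₚ.<? σ v) (allFin⁺ n))

  rep-surjective : ∀ v → v Fin.< σ v → ∃[ i ] rep i ≡ v
  rep-surjective v v<σv = Any.index v∈ , sym (lookup-index v∈)
    where v∈ = ∈-filter⁺ (λ v → v Finₚ.<? σ v) (∈-allFin v) v<σv

  ≮σ⇒σ< : ∀ v → ¬ (v Fin.< σ v) → σ v Fin.< σ (σ v)
  ≮σ⇒σ< v v≮σv = subst (σ v Fin.<_) (sym (σ-involutive v))
    (≤∧≢⇒< (≮⇒≥ v≮σv) (λ same → σ-fixed-point-free v (toℕ-injective same)))

  encode : ∀ v → Dec (v Fin.< σ v) → Fin m × Bool
  encode v (yes v<σv) = proj₁ (rep-surjective v v<σv) , false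
  encode v (no v≮σv)  = proj₁ (rep-surjective (σ v) (≮σ⇒σ< v v≮σv)) , true

  decode : Fin m × Bool → Fin n
  decode (i , false) = rep i
  decode (i , true)  = σ (rep i)

  decode-encode : ∀ v d → decode (encode v d) ≡ v
  decode-encode v (yes v<σv) = proj₂ (rep-surjective v v<σv)
  decode-encode v (no v≮σv)  = trans (cong σ (proj₂ (rep-surjective (σ v) (≮σ⇒σ< v v≮σv)))) (σ-involutive v)

  encode-decode : ∀ x d → encode (decode x) d ≡ x
  encode-decode (i , false) (yes r<σr) = cong (_, false) (rep-injective (proj₂ (rep-surjective (rep i) r<σr)))
  encode-decode (i , false) (no r≮σr)  = ⊥-elim (r≮σr (rep< i))
  encode-decode (i , true)  (yes σr<σσr) =
    ⊥-elim (<-asym (rep< i) (subst (σ (rep i) Fin.<_) (σ-involutive (rep i)) σr<σσr))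
  encode-decode (i , true)  (no σr≮σσr) =
    cong (_, true) (rep-injective (trans (proj₂ (rep-surjective _ (≮σ⇒σ< _ σr≮σσr))) (σ-involutive (rep i))))

  encode-σ : ∀ v d d′ → encode (σ v) d′ ≡ negate (encode v d)
  encode-σ v (yes v<σv) (yes σv<σσv) = ⊥-elim (<-asym v<σv (subst (σ v Fin.<_) (σ-involutive v) σv<σσv))
  encode-σ v (yes v<σv) (no σv≮σσv)  = cong (_, true) (rep-injective
    (trans (proj₂ (rep-surjective _ (≮σ⇒σ< _ σv≮σσv))) (trans (σ-involutive v) (sym (proj₂ (rep-surjective v v<σv))))))
  encode-σ v (no v≮σv)  (yes σv<σσv) = cong (_, false) (rep-injective
    (trans (proj₂ (rep-surjective _ σv<σσv)) (sym (proj₂ (rep-surjective _ (≮σ⇒σ< v v≮σv))))))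
  encode-σ v (no v≮σv)  (no σv≮σσv)  = ⊥-elim (σv≮σσv (≮σ⇒σ< v v≮σv))

  signing : Fin n ↔ (Fin m × Bool)
  signing = mk↔ₛ′ (λ v → encode v (v Finₚ.<? σ v)) decode
                  (λ x → encode-decode x (decode x Finₚ.<? σ (decode x)))
                  (λ v → decode-encode v (v Finₚ.<? σ v))

  signing-σ : ∀ v → Inverse.to signing (σ v) ≡ negate (Inverse.to signing v)
  signing-σ v = encode-σ v (v Finₚ.<? σ v) (σ v Finₚ.<? σ (σ v))

  n≡2m : n ≡ 2 * m
  n≡2m = trans (↔⇒≡ (↔-sym (*↔× {m} {2}) ↔-∘ ((↔-id (Fin m) ×-↔ ↔-sym 2↔Bool) ↔-∘ signing))) (*-comm m 2)

module ProperlyColoured {n k : ℕ} (c : Coloring n k) (simple : IsSimple c) (proper : IsProper c) where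

  τ-edge : ∀ {a i j} → c i j ≡ just a → τ c a i ≡ j
  τ-edge {a} {i} {j} edge with any? (λ j → ≡-dec _≟_ (c i j) (just a))
  ... | yes (j′ , edge′) = proper i j′ j a edge′ edge
  ... | no noEdge        = ⊥-elim (noEdge (j , edge))

  τ-moved⇒edge : ∀ {a i} → τ c a i ≢ i → c i (τ c a i) ≡ just a
  τ-moved⇒edge {a} {i} moved with any? (λ j → ≡-dec _≟_ (c i j) (just a))
  ... | yes (_ , edge) = edge
  ... | no _           = ⊥-elim (moved refl)

  τ-involutive : ∀ a i → τ c a (τ c a i) ≡ i
  τ-involutive a i with τ c a i ≟ i
  ... | yes fixed = trans (cong (τ c a) fixed) fixed
  ... | no moved  = τ-edge (trans (proj₂ simple (τ c a i) i) (τ-moved⇒edge moved))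

  τ-moved⇒adjacent : ∀ {a i} → τ c a i ≢ i → Adj c i (τ c a i)
  τ-moved⇒adjacent moved noEdge with () ← trans (sym (τ-moved⇒edge moved)) noEdge

  τ-same-image⇒same-colour : ∀ {a b u} → τ c a u ≡ τ c b u → τ c a u ≢ u → a ≡ b
  τ-same-image⇒same-colour {a} {b} {u} same moved = just-injective (begin
    just a             ≡⟨ sym (τ-moved⇒edge moved) ⟩
    c u (τ c a u)      ≡⟨ cong (c u) same ⟩
    c u (τ c b u)      ≡⟨ τ-moved⇒edge (λ fixed → moved (trans same fixed)) ⟩
    just b             ∎)

  -- Applies the letters left to right, whereas evalWord applies the last letter first.
  walk : Fin n → List (Fin k) → Fin n
  walk v []      = v
  walk v (a ∷ w) = walk (τ c a v) w

  walk-++ : ∀ v xs {ys} → walk v (xs ++ ys) ≡ walk (walk v xs) ys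
  walk-++ v []       = refl
  walk-++ v (a ∷ xs) = walk-++ (τ c a v) xs

  IsWalk⇒word : ∀ ℓ p → IsWalk c ℓ p → ∃[ w ] walk (p zero) w ≡ p (fromℕ ℓ)
  IsWalk⇒word zero    p _    = [] , refl
  IsWalk⇒word (suc ℓ) p isWalk with c (p zero) (p (suc zero)) in edge
  ... | nothing = ⊥-elim (isWalk zero edge)
  ... | just a with IsWalk⇒word ℓ (p ∘ suc) (isWalk ∘ suc)
  ...   | w , reaches = a ∷ w , trans (cong (λ v → walk v w) (τ-edge edge)) reaches

  route : Connected c → ∀ u v → ∃[ w ] walk u w ≡ v
  route connected u v with connected u v
  ... | ℓ , p , isWalk , refl , refl = IsWalk⇒word ℓ p isWalk

  Moving : Fin n → List (Fin k) → Set
  Moving v []      = ⊤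
  Moving v (a ∷ w) = τ c a v ≢ v × Moving (τ c a v) w

  -- Consecutive colours differ: since the colouring is proper, no edge is immediately walked back.
  NonBacktracking : Fin n → List (Fin k) → Set
  NonBacktracking v w = Moving v w × Linked _≢_ w

  Moving-++⁺ : ∀ v xs {ys} → Moving v xs → Moving (walk v xs) ys → Moving v (xs ++ ys)
  Moving-++⁺ v []       _                  moving = moving
  Moving-++⁺ v (a ∷ xs) (moved , movingˣ) moving = moved , Moving-++⁺ (τ c a v) xs movingˣ moving

  Moving-++⁻ : ∀ v xs {ys} → Moving v (xs ++ ys) → Moving v xs × Moving (walk v xs) ys
  Moving-++⁻ v []       moving           = tt , moving
  Moving-++⁻ v (a ∷ xs) (moved , moving) with Moving-++⁻ (τ c a v) xs moving
  ... | movingˣ , movingʸ = (moved , movingˣ) , movingʸ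

  NonBacktracking-++⁻ : ∀ v xs {ys} → NonBacktracking v (xs ++ ys) →
                        NonBacktracking v xs × NonBacktracking (walk v xs) ys
  NonBacktracking-++⁻ v xs (moving , linked) with Moving-++⁻ v xs moving | Linked-++⁻ xs linked
  ... | movingˣ , movingʸ | linkedˣ , linkedʸ = (movingˣ , linkedˣ) , (movingʸ , linkedʸ)

  vertexAt : Fin n → List (Fin k) → ℕ → Fin n
  vertexAt v w i = walk v (take i w)

  NonBacktracking-take : ∀ {v} i w → NonBacktracking v w → NonBacktracking v (take i w)
  NonBacktracking-take {v} i w nb =
    proj₁ (NonBacktracking-++⁻ v (take i w) (subst (NonBacktracking v) (sym (take++drop≡id i w)) nb))

  NonBacktracking-drop : ∀ {v} i w → NonBacktracking v w → NonBacktracking (vertexAt v w i) (drop i w)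
  NonBacktracking-drop {v} i w nb =
    proj₂ (NonBacktracking-++⁻ v (take i w) (subst (NonBacktracking v) (sym (take++drop≡id i w)) nb))

  walk-take-drop : ∀ v w i j → walk (vertexAt v w i) (take j (drop i w)) ≡ vertexAt v w (i + j)
  walk-take-drop v w       zero    j       = refl
  walk-take-drop v []      (suc i) zero    = refl
  walk-take-drop v []      (suc i) (suc j) = refl
  walk-take-drop v (a ∷ w) (suc i) j       = walk-take-drop (τ c a v) w i j

  Moving⇒adjacent : ∀ {v} w {i} → Moving v w → i < length w → Adj c (vertexAt v w i) (vertexAt v w (suc i))
  Moving⇒adjacent (a ∷ w) {zero}  (moved , _)      _         = τ-moved⇒adjacent moved
  Moving⇒adjacent (a ∷ w) {suc i} (_     , moving) (s≤s i<ℓ) = Moving⇒adjacent w moving i<ℓ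

  ClosedNonBacktrackingWalk : ℕ → Set
  ClosedNonBacktrackingWalk ℓ = ∃₂ λ v w → length w ≡ ℓ × NonBacktracking v w × walk v w ≡ v

  repeated-vertex⇒closed-walk : ∀ {v} w {i j} → NonBacktracking v w → i < j → j ≤ length w →
                                vertexAt v w i ≡ vertexAt v w j → ClosedNonBacktrackingWalk (j ∸ i)
  repeated-vertex⇒closed-walk {v} w {i} {j} nb i<j j≤ℓ repeated =
    vertexAt v w i , segment , length-segment ,
    NonBacktracking-take (j ∸ i) (drop i w) (NonBacktracking-drop i w nb) , closes
    where
      segment = take (j ∸ i) (drop i w)
      length-segment : length segment ≡ j ∸ i
      length-segment = begin
        length segment               ≡⟨ length-take (j ∸ i) (drop i w) ⟩
        (j ∸ i) ⊓ length (drop i w)  ≡⟨ m≤n⇒m⊓n≡m (subst (j ∸ i ≤_) (sym (length-drop i w)) (∸-monoˡ-≤ i j≤ℓ)) ⟩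
        j ∸ i                        ∎
      closes : walk (vertexAt v w i) segment ≡ vertexAt v w i
      closes = begin
        walk (vertexAt v w i) segment ≡⟨ walk-take-drop v w i (j ∸ i) ⟩
        vertexAt v w (i + (j ∸ i))    ≡⟨ cong (vertexAt v w) (m+[n∸m]≡n (<⇒≤ i<j)) ⟩
        vertexAt v w j                ≡⟨ sym repeated ⟩
        vertexAt v w i                ∎

  shortcut : ∀ x u → ∃[ r ] NonBacktracking x r × walk x r ≡ walk x u
  shortcut x []      = [] , (tt , []) , refl
  shortcut x (a ∷ u) with τ c a x ≟ x
  ... | yes fixed with shortcut x u
  ...   | r , nb , reaches = r , nb , trans reaches (cong (λ y → walk y u) (sym fixed))
  shortcut x (a ∷ u) | no moved with shortcut (τ c a x) u
  ...   | [] , _ , reaches = [ a ] , ((moved , tt) , [-]) , reaches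
  ...   | b ∷ r , ((movedᵇ , moving) , linked) , reaches with a ≟ b
  ...     | yes refl = r , (subst (λ y → Moving y r) (τ-involutive a x) moving , Linked.tail linked) ,
                       trans (cong (λ y → walk y r) (sym (τ-involutive a x))) reaches
  ...     | no a≢b   = a ∷ b ∷ r , ((moved , movedᵇ , moving) , a≢b ∷ linked) , reaches

  distinct-closed-walk⇒cycle : ∀ {v a b d} w → let w′ = a ∷ b ∷ d ∷ w in
    Moving v w′ → walk v w′ ≡ v → Injective _≡_ _≡_ (λ (i : Fin (length w′)) → vertexAt v w′ (toℕ i)) →
    IsCycle c (length w) (λ i → vertexAt v w′ (toℕ i))
  distinct-closed-walk⇒cycle {v} {a} {b} {d} w moving closed distinct =
    (λ _ _ → distinct) , steps , closing
    where
      w′ = a ∷ b ∷ d ∷ w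
      steps : IsWalk c (suc (suc (length w))) (λ i → vertexAt v w′ (toℕ i))
      steps i = subst (λ j → Adj c (vertexAt v w′ j) (vertexAt v w′ (suc (toℕ i)))) (sym (toℕ-inject₁ i))
                      (Moving⇒adjacent w′ moving (s≤s (<⇒≤ (toℕ<n i))))
      closing : Adj c (vertexAt v w′ (toℕ (fromℕ (suc (suc (length w)))))) v
      closing = subst₂ (λ j u → Adj c (vertexAt v w′ j) u) (sym (toℕ-fromℕ (suc (suc (length w))))) ends
                       (Moving⇒adjacent w′ moving ≤-refl)
        where ends = trans (cong (walk v) (take-all (length w′) w′ ≤-refl)) closed

  module _ (acyclic : Acyclic c) where

    closed-walk-not-distinct : ∀ {v} w → 0 < length w → NonBacktracking v w → walk v w ≡ v →
                               ¬ Injective _≡_ _≡_ (λ (i : Fin (length w)) → vertexAt v w (toℕ i))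
    closed-walk-not-distinct (a ∷ [])         _ ((moved , _) , _) closed _ = moved closed
    closed-walk-not-distinct {v} (a ∷ b ∷ []) _ ((_ , movedᵇ , _) , a≢b ∷ [-]) closed _ =
      a≢b (sym (τ-same-image⇒same-colour (trans closed (sym (τ-involutive a v))) movedᵇ))
    closed-walk-not-distinct (a ∷ b ∷ d ∷ w)  _ (moving , _) closed distinct =
      acyclic (length w) _ (distinct-closed-walk⇒cycle w moving closed distinct)

    no-closed-walk : ∀ ℓ → 0 < ℓ → ¬ ClosedNonBacktrackingWalk ℓ
    no-closed-walk = <-rec (λ ℓ → 0 < ℓ → ¬ ClosedNonBacktrackingWalk ℓ) step
      where
        step : ∀ ℓ → (∀ {ℓ′} → ℓ′ < ℓ → 0 < ℓ′ → ¬ ClosedNonBacktrackingWalk ℓ′) →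
               0 < ℓ → ¬ ClosedNonBacktrackingWalk ℓ
        step _ shorter nonempty (v , w , refl , nb , closed)
          with collision-or-injective _≟_ (λ (i : Fin (length w)) → vertexAt v w (toℕ i))
        ... | inj₁ (i , j , i<j , repeated) =
          shorter (≤-<-trans (m∸n≤m (toℕ j) (toℕ i)) (toℕ<n j)) (m<n⇒0<n∸m i<j)
                  (repeated-vertex⇒closed-walk w nb i<j (<⇒≤ (toℕ<n j)) repeated)
        ... | inj₂ distinct = closed-walk-not-distinct w nonempty nb closed distinct

    NonBacktracking⇒length< : ∀ {v} w → NonBacktracking v w → length w < n
    NonBacktracking⇒length< {v} w nb with length w <? n
    ... | yes short = short
    ... | no long with pigeonhole (s≤s (≮⇒≥ long)) (λ (i : Fin (suc (length w))) → vertexAt v w (toℕ i))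
    ...   | i , j , i<j , repeated =
      ⊥-elim (no-closed-walk _ (m<n⇒0<n∸m i<j) (repeated-vertex⇒closed-walk w nb i<j (≤-pred (toℕ<n j)) repeated))

  Commutes : (Fin n → Fin n) → Set
  Commutes f = ∀ a v → f (τ c a v) ≡ τ c a (f v)

  Commutes-walk : ∀ {f} → Commutes f → ∀ v w → f (walk v w) ≡ walk (f v) w
  Commutes-walk comm v []      = refl
  Commutes-walk comm v (a ∷ w) = trans (Commutes-walk comm (τ c a v) w) (cong (λ u → walk u w) (comm a v))

  Commutes-∘ : ∀ {f g} → Commutes f → Commutes g → Commutes (f ∘ g)
  Commutes-∘ {f} f-comm g-comm a v = trans (cong f (g-comm a v)) (f-comm a _)

  Commutes-moving : ∀ {σ} → Commutes σ → Injective _≡_ _≡_ σ → ∀ {v} w → Moving v w → Moving (σ v) w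
  Commutes-moving comm inj []      _                 = tt
  Commutes-moving comm inj (a ∷ w) (moved , moving) =
    (λ fixed → moved (inj (trans (comm a _) fixed))) ,
    subst (λ u → Moving u w) (comm a _) (Commutes-moving comm inj w moving)

  commuting-maps-agree : Connected c → ∀ {f g} → Commutes f → Commutes g →
                         ∀ {x} → f x ≡ g x → ∀ v → f v ≡ g v
  commuting-maps-agree connected {f} {g} f-comm g-comm {x} agree v with route connected x v
  ... | w , reaches = begin
    f v           ≡⟨ cong f (sym reaches) ⟩
    f (walk x w)  ≡⟨ Commutes-walk f-comm x w ⟩
    walk (f x) w  ≡⟨ cong (λ u → walk u w) agree ⟩
    walk (g x) w  ≡⟨ Commutes-walk g-comm x w ⟨
    g (walk x w)  ≡⟨ cong g reaches ⟩
    g v           ∎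

  commuting-fixed-point⇒identity : Connected c → ∀ {f} → Commutes f → ∀ {x} → f x ≡ x → ∀ v → f v ≡ v
  commuting-fixed-point⇒identity connected comm = commuting-maps-agree connected {g = id} comm (λ _ _ → refl)

  module _ {σ : Fin n → Fin n} (σ-comm : Commutes σ) (σ-inj : Injective _≡_ _≡_ σ) where

    Moving-power : ∀ {x} w → Moving x w → walk x w ≡ σ x → ∀ j → Moving x (concat (replicate j w))
    Moving-power     w moving reaches zero    = tt
    Moving-power {x} w moving reaches (suc j) =
      Moving-++⁺ x w moving (subst (λ u → Moving u (concat (replicate j w))) (sym reaches)
        (Moving-power w (Commutes-moving σ-comm σ-inj w moving)
                      (trans (sym (Commutes-walk σ-comm x w)) (cong σ reaches)) j))

    module _ (acyclic : Acyclic c) where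

      path-to-translate-turns-back : ∀ {x a} m z → NonBacktracking x (a ∷ m ∷ʳ z) →
                                     walk x (a ∷ m ∷ʳ z) ≡ σ x → a ≡ z
      path-to-translate-turns-back {x} {a} m z nb reaches with a ≟ z
      ... | yes a≡z = a≡z
      ... | no a≢z  = ⊥-elim (<⇒≱ (NonBacktracking⇒length< acyclic (concat (replicate n w)) (moving , linked))
                                   (length-concat-replicate a (m ∷ʳ z) n))
        where
          w = a ∷ m ∷ʳ z
          moving = Moving-power w (proj₁ nb) reaches n
          linked = Linked-concat-replicate (proj₂ nb)
                     (subst (λ l → MaybeConnected _≢_ l (just a)) (sym (last-∷ʳ (a ∷ m) z))
                            (just (λ z≡a → a≢z (sym z≡a))))
                     n

      involutive-point : ∀ {x} w → NonBacktracking x w → walk x w ≡ σ x → ∃[ y ] σ (σ y) ≡ y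
      involutive-point w = <-rec P step (length w) w refl
        where
          P : ℕ → Set
          P ℓ = ∀ {x} w → length w ≡ ℓ → NonBacktracking x w → walk x w ≡ σ x → ∃[ y ] σ (σ y) ≡ y
          step : ∀ ℓ → (∀ {ℓ′} → ℓ′ < ℓ → P ℓ′) → P ℓ
          step _ _ {x} [] _ _ reaches = x , trans (cong σ (sym reaches)) (sym reaches)
          step _ shorter {x} (a ∷ t) refl nb reaches with initLast t
          ... | [] = x , (begin
            σ (σ x)          ≡⟨ cong σ (sym reaches) ⟩
            σ (τ c a x)      ≡⟨ σ-comm a x ⟩
            τ c a (σ x)      ≡⟨ cong (τ c a) (sym reaches) ⟩
            τ c a (τ c a x)  ≡⟨ τ-involutive a x ⟩
            x                ∎)
          ... | m ∷ʳ′ z with path-to-translate-turns-back m z nb reaches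
          ...   | refl = shorter (s≤s (length-++-≤ˡ m)) m refl nb′ reaches′
            where
              nb′ = proj₁ (NonBacktracking-++⁻ (τ c a x) m (proj₂ (proj₁ nb) , Linked.tail (proj₂ nb)))
              y = walk (τ c a x) m
              reaches′ : y ≡ σ (τ c a x)
              reaches′ = begin
                y                ≡⟨ τ-involutive a y ⟨
                τ c a (τ c a y)  ≡⟨ cong (τ c a) (trans (sym (walk-++ (τ c a x) m)) reaches) ⟩
                τ c a (σ x)      ≡⟨ σ-comm a x ⟨
                σ (τ c a x)      ∎

      commuting-injective⇒involutive : Connected c → ∀ v → σ (σ v) ≡ v
      commuting-injective⇒involutive connected v with route connected v (σ v)
      ... | u , reaches with shortcut v u
      ...   | w , nb , same with involutive-point w nb (trans same reaches)
      ...     | y , σσy≡y = commuting-fixed-point⇒identity connected (Commutes-∘ σ-comm σ-comm) σσy≡y v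

  evalWord-walk : ∀ w x → evalWord c w (walk x w) ≡ x
  evalWord-walk []      x = refl
  evalWord-walk (a ∷ w) x = trans (cong (τ c a) (evalWord-walk w (τ c a x))) (τ-involutive a x)

  walk-evalWord : ∀ w x → walk (evalWord c w x) w ≡ x
  walk-evalWord []      x = refl
  walk-evalWord (a ∷ w) x = trans (cong (λ y → walk y w) (τ-involutive a (evalWord c w x))) (walk-evalWord w x)

  Commutes-evalWord : ∀ {σ} → Commutes σ → ∀ w x → σ (evalWord c w x) ≡ evalWord c w (σ x)
  Commutes-evalWord comm []      x = refl
  Commutes-evalWord comm (a ∷ w) x = trans (comm a _) (cong (τ c a) (Commutes-evalWord comm w x))

  module Conjugation {m : ℕ} {σ : Fin n → Fin n} (σ-comm : Commutes σ)
                     (e : Fin n ↔ (Fin m × Bool)) (e-σ : ∀ v → Inverse.to e (σ v) ≡ negate (Inverse.to e v)) where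

    open Inverse e using (to; from; strictlyInverseˡ; strictlyInverseʳ)

    from-negate : ∀ x → from (negate x) ≡ σ (from x)
    from-negate x = begin
      from (negate x)              ≡⟨ cong (from ∘ negate) (strictlyInverseˡ x) ⟨
      from (negate (to (from x)))  ≡⟨ cong from (e-σ (from x)) ⟨
      from (to (σ (from x)))       ≡⟨ strictlyInverseʳ (σ (from x)) ⟩
      σ (from x)                   ∎

    conjugate : List (Fin k) → SignedPerm m
    conjugate w = mk↔ₛ′ (to ∘ evalWord c w ∘ from) (to ∘ (λ v → walk v w) ∘ from) cancelˡ cancelʳ , odd
      where
        cancelˡ : ∀ x → to (evalWord c w (from (to (walk (from x) w)))) ≡ x
        cancelˡ x = begin
          to (evalWord c w (from (to (walk (from x) w)))) ≡⟨ cong (to ∘ evalWord c w) (strictlyInverseʳ _) ⟩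
          to (evalWord c w (walk (from x) w))             ≡⟨ cong to (evalWord-walk w (from x)) ⟩
          to (from x)                                     ≡⟨ strictlyInverseˡ x ⟩
          x                                               ∎
        cancelʳ : ∀ x → to (walk (from (to (evalWord c w (from x)))) w) ≡ x
        cancelʳ x = begin
          to (walk (from (to (evalWord c w (from x)))) w) ≡⟨ cong (λ v → to (walk v w)) (strictlyInverseʳ _) ⟩
          to (walk (evalWord c w (from x)) w)             ≡⟨ cong to (walk-evalWord w (from x)) ⟩
          to (from x)                                     ≡⟨ strictlyInverseˡ x ⟩
          x                                               ∎
        odd : ∀ x → to (evalWord c w (from (negate x))) ≡ negate (to (evalWord c w (from x)))
        odd x = begin
          to (evalWord c w (from (negate x)))  ≡⟨ cong (to ∘ evalWord c w) (from-negate x) ⟩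
          to (evalWord c w (σ (from x)))       ≡⟨ cong to (Commutes-evalWord σ-comm w (from x)) ⟨
          to (σ (evalWord c w (from x)))       ≡⟨ e-σ _ ⟩
          negate (to (evalWord c w (from x)))  ∎

    embedding : EmbedsInto c m
    embedding = (λ _ (w , _) → conjugate w) , respects , homomorphic , injective
      where
        respects : ∀ f g pf pg → (∀ i → f i ≡ g i) → conjugate (proj₁ pf) ≈B conjugate (proj₁ pg)
        respects f g (u , f≡u) (w , g≡w) f≗g x = cong to (begin
          evalWord c u (from x)  ≡⟨ f≡u (from x) ⟨
          f (from x)             ≡⟨ f≗g (from x) ⟩
          g (from x)             ≡⟨ g≡w (from x) ⟩
          evalWord c w (from x)  ∎)
        homomorphic : ∀ f g pf pg (pfg : InColoringGroup c (f ∘ g)) → ∀ x →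
          apply (conjugate (proj₁ pfg)) x ≡ apply (conjugate (proj₁ pf)) (apply (conjugate (proj₁ pg)) x)
        homomorphic f g (u , f≡u) (w , g≡w) (uw , fg≡uw) x = cong to (begin
          evalWord c uw (from x)                             ≡⟨ fg≡uw (from x) ⟨
          f (g (from x))                                     ≡⟨ f≡u _ ⟩
          evalWord c u (g (from x))                          ≡⟨ cong (evalWord c u) (g≡w (from x)) ⟩
          evalWord c u (evalWord c w (from x))               ≡⟨ cong (evalWord c u) (strictlyInverseʳ _) ⟨
          evalWord c u (from (to (evalWord c w (from x))))   ∎)
        injective : ∀ f g pf pg → conjugate (proj₁ pf) ≈B conjugate (proj₁ pg) → ∀ i → f i ≡ g i
        injective f g (u , f≡u) (w , g≡w) same i = begin
          f i                                     ≡⟨ f≡u i ⟩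
          evalWord c u i                          ≡⟨ strictlyInverseʳ _ ⟨
          from (to (evalWord c u i))              ≡⟨ cong (λ v → from (to (evalWord c u v))) (strictlyInverseʳ i) ⟨
          from (to (evalWord c u (from (to i))))  ≡⟨ cong from (same (to i)) ⟩
          from (to (evalWord c w (from (to i))))  ≡⟨ cong (λ v → from (to (evalWord c w v))) (strictlyInverseʳ i) ⟩
          from (to (evalWord c w i))              ≡⟨ strictlyInverseʳ _ ⟩
          evalWord c w i                          ≡⟨ g≡w i ⟨
          g i                                     ∎

  centralizing⇒Commutes : (π : Permutation′ n) →
    (∀ f → InColoringGroup c f → ∀ i → π ⟨$⟩ʳ (f i) ≡ f (π ⟨$⟩ʳ i)) → Commutes (π ⟨$⟩ʳ_)
  centralizing⇒Commutes π centralizes a = centralizes (τ c a) ([ a ] , λ _ → refl)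

  module Centralizer (connected : Connected c) (o : Fin n) where

    -- The only possible map commuting with all τ_a that sends o to y.
    candidate : Fin n → Fin n → Fin n
    candidate y v = walk y (proj₁ (route connected o v))

    Commutes⇒candidate : ∀ {f} → Commutes f → ∀ v → f v ≡ candidate (f o) v
    Commutes⇒candidate {f} comm v with route connected o v
    ... | w , reaches = trans (cong f (sym reaches)) (Commutes-walk comm o w)

    NontrivialCentralizing : Fin n → Set
    NontrivialCentralizing y = candidate y o ≢ o × Commutes (candidate y) × Injective _≡_ _≡_ (candidate y)

    nontrivialCentralizing? : ∀ y → Dec (NontrivialCentralizing y)
    nontrivialCentralizing? y =
      ¬? (σ o ≟ o) ×-dec
      all? (λ a → all? (λ v → σ (τ c a v) ≟ τ c a (σ v))) ×-dec
      map′ (λ inj {u} {v} → inj u v) (λ inj u v → inj)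
           (all? (λ u → all? (λ v → (σ u ≟ σ v) →-dec (u ≟ v))))
      where σ = candidate y

    Commutes⇒NontrivialCentralizing : (π : Permutation′ n) → Commutes (π ⟨$⟩ʳ_) → π ⟨$⟩ʳ o ≢ o →
                                      NontrivialCentralizing (π ⟨$⟩ʳ o)
    Commutes⇒NontrivialCentralizing π π-comm moved = moved′ , comm′ , inj′
      where
        π≗ = Commutes⇒candidate π-comm
        moved′ = λ fixed → moved (trans (π≗ o) fixed)
        comm′ : Commutes (candidate (π ⟨$⟩ʳ o))
        comm′ a v = trans (sym (π≗ _)) (trans (π-comm a v) (cong (τ c a) (π≗ v)))
        inj′ : Injective _≡_ _≡_ (candidate (π ⟨$⟩ʳ o))
        inj′ {u} {v} same = begin
          u                    ≡⟨ inverseˡ π ⟨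
          π ⟨$⟩ˡ (π ⟨$⟩ʳ u)    ≡⟨ cong (π ⟨$⟩ˡ_) (trans (π≗ u) (trans same (sym (π≗ v)))) ⟩
          π ⟨$⟩ˡ (π ⟨$⟩ʳ v)    ≡⟨ inverseˡ π ⟩
          v                    ∎

    centralizer-trivial : ¬ ∃ NontrivialCentralizing → CentralizerTrivial c
    centralizer-trivial none π centralizes with centralizing⇒Commutes π centralizes | π ⟨$⟩ʳ o ≟ o
    ... | π-comm | yes fixed = commuting-fixed-point⇒identity connected π-comm fixed
    ... | π-comm | no moved  = ⊥-elim (none (π ⟨$⟩ʳ o , Commutes⇒NontrivialCentralizing π π-comm moved))

theorem3p11 : (n k : ℕ) (c : Coloring n k) →
    IsTree c → IsProperEdgeColoring c →
    CentralizerTrivial c ⊎ (∃[ m ] (n ≡ 2 * m × EmbedsInto c m))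
theorem3p11 zero    k c _                             _            = inj₁ (λ _ _ ())
theorem3p11 (suc n) k c (simple , connected , acyclic) (proper , _) =
  case any? nontrivialCentralizing? of λ where
    (no none)        → inj₁ (centralizer-trivial none)
    (yes nontrivial) → inj₂ (signed-embedding nontrivial)
  where
    open ProperlyColoured c simple proper
    open Centralizer connected zero

    signed-embedding : ∃ NontrivialCentralizing → ∃[ m ] (suc n ≡ 2 * m × EmbedsInto c m)
    signed-embedding (y , moves-o , σ-comm , σ-inj) =
      m , n≡2m , Conjugation.embedding σ-comm signing signing-σ
      where
        σ = candidate y
        open FixedPointFreeInvolution σ (commuting-injective⇒involutive σ-comm σ-inj acyclic connected)
               (λ v fixed → moves-o (commuting-fixed-point⇒identity connected σ-comm fixed zero))
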